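{- Let $k$ be a nonnegative integer and let $G$ be a connected graph with $\Delta(G)\geq k+2$. If $S=\{u_1,\ldots,u_t\}$ is a minimum $k$-power dominating set of $G$ in which every vertex has at least $k+1$ external $S$-private neighbors, then \[Z_k(G)\le \sum_{i=1}^t(\deg u_i+1-k).\]
   Context: Graphs are finite, simple and undirected; $\Delta(G)$ is the maximum degree. For $S\subseteq V$ and $v\in S$, an $S$-private neighbor of $v$ is a vertex $x\in N(v)$ with $x\notin N(S\setminus\{v\})$; it is external if moreover $x\notin S$. For a graph $G=(V,E)$, nonnegative integer $k$: for $T\subseteq V$, $\mathscr F^0_{G,k}(T)=T$, $\mathscr F^{i+1}_{G,k}(T)=\mathscr F^i_{G,k}(T)\cup\bigcup\{N(v): v\in \mathscr F^i_{G,k}(T),\ 1\le |N(v)\setminus \mathscr F^i_{G,k}(T)|\le k\}$; $T$ is a $k$-forcing set if $\mathscr F^t_{G,k}(T)=V$ for some $t$, and $Z_k(G)$ is the minimum size of one. For $S\subseteq V$, $\mathscr P^0_{G,k}(S)=N[S]$ and $\mathscr P^{i+1}_{G,k}(S)$ is defined by the same rule; $S$ is a $k$-power dominating set if $\mathscr P^\ell_{G,k}(S)=V$ for some $\ell$; a minimum one has smallest cardinality. -}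

module Defs where

open import Data.Bool using (Bool; true; false; _∧_; _∨_; not; if_then_else_)
open import Data.Nat using (ℕ; zero; suc; _+_; _∸_; _≤_; _≤ᵇ_)
open import Data.Fin using (Fin; zero; suc; _≟_)
open import Data.Fin.Subset using (Subset; ⊤; ∣_∣; _─_)
open import Data.Vec using (Vec; tabulate; lookup)
open import Data.Product using (Σ; _×_; ∃; ∃-syntax; _,_)
open import Relation.Binary.PropositionalEquality using (_≡_; _≢_)
open import Relation.Nullary.Decidable using (⌊_⌋)

record Graph (n : ℕ) : Set where
  field
    adj    : Fin n → Fin n → Bool
    sym    : ∀ u v → adj u v ≡ adj v u
    irrefl : ∀ v → adj v v ≡ false
open Graph public

anyFin : ∀ {n} → (Fin n → Bool) → Bool
anyFin {zero}  f = false
anyFin {suc n} f = f zero ∨ anyFin (λ i → f (suc i))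

allFin : ∀ {n} → (Fin n → Bool) → Bool
allFin {zero}  f = true
allFin {suc n} f = f zero ∧ allFin (λ i → f (suc i))

sumFin : ∀ {n} → (Fin n → ℕ) → ℕ
sumFin {zero}  f = 0
sumFin {suc n} f = f zero + sumFin (λ i → f (suc i))

module _ {n : ℕ} (G : Graph n) where

  N : Fin n → Subset n
  N v = tabulate (adj G v)

  deg : Fin n → ℕ
  deg v = ∣ N v ∣

  MaxDegAtLeast : ℕ → Set
  MaxDegAtLeast m = ∃[ v ] (m ≤ deg v)

  data Reach : Fin n → Fin n → Set where
    here : ∀ {u} → Reach u u
    step : ∀ {u v w} → adj G u v ≡ true → Reach v w → Reach u w

  Connected : Set
  Connected = ∀ u v → Reach u v

  closedN : Subset n → Subset n
  closedN S = tabulate (λ x → lookup S x ∨ anyFin (λ v → lookup S v ∧ adj G v x))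

  canForce : ℕ → Subset n → Fin n → Bool
  canForce k F v = lookup F v ∧ (1 ≤ᵇ ∣ N v ─ F ∣) ∧ (∣ N v ─ F ∣ ≤ᵇ k)

  stepF : ℕ → Subset n → Subset n
  stepF k F = tabulate (λ x → lookup F x ∨ anyFin (λ v → canForce k F v ∧ adj G v x))

  iterF : ℕ → ℕ → Subset n → Subset n
  iterF k zero    T = T
  iterF k (suc i) T = stepF k (iterF k i T)

  IsKForcing : ℕ → Subset n → Set
  IsKForcing k T = ∃[ t ] (iterF k t T ≡ ⊤)

  IsZk : ℕ → ℕ → Set
  IsZk k z = (∃[ T ] (IsKForcing k T × ∣ T ∣ ≡ z))
           × (∀ T → IsKForcing k T → z ≤ ∣ T ∣)

  iterP : ℕ → ℕ → Subset n → Subset n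
  iterP k ℓ S = iterF k ℓ (closedN S)

  IsKPowerDominating : ℕ → Subset n → Set
  IsKPowerDominating k S = ∃[ ℓ ] (iterP k ℓ S ≡ ⊤)

  IsMinimumKPDS : ℕ → Subset n → Set
  IsMinimumKPDS k S = IsKPowerDominating k S
                    × (∀ S′ → IsKPowerDominating k S′ → ∣ S ∣ ≤ ∣ S′ ∣)

  extPrivate : Subset n → Fin n → Subset n
  extPrivate S v = tabulate (λ x →
      adj G v x
    ∧ not (lookup S x)
    ∧ allFin (λ w → not (lookup S w ∧ not ⌊ w ≟ v ⌋ ∧ adj G w x)))

  sumOver : Subset n → (Fin n → ℕ) → ℕ
  sumOver S f = sumFin (λ v → if lookup S v then f v else 0)

-- Let S be a k-power dominating set with deg u ≥ k for u ∈ S. For each u ∈ S keep u and all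
-- but k of its neighbours; the union T of these sets has at most Σ (deg u + 1 − k) elements.
-- Every u ∈ S lies in T and has at most k neighbours outside T, so one forcing round from T
-- already covers N[S]. Since forcing is monotone in the set of observed vertices, T then
-- observes at least what N[S] does at each later round, so T is a k-forcing set.

module Submission where

open import Defs hiding (sym)
open import Data.Nat using (ℕ; suc; _+_; _∸_; _≤_)
open import Data.Fin using (Fin)
open import Data.Fin.Subset using (Subset; _∈_; ∣_∣)

open import Data.Bool using (Bool; T; if_then_else_)
open import Data.Bool.Properties using (T-≡; T-∧; T-∨)
open import Data.Nat using (zero; z≤n; s≤s; _⊓_)
open import Data.Nat.Properties
  using (≤-trans; ≤-reflexive; +-mono-≤; +-monoʳ-≤; n≤1+n; +-suc; +-comm;
         m⊓n≤m; m≤n⇒m⊓n≡m; m+n∸n≡m; +-∸-comm; m≤m+n; ≤ᵇ⇒≤; ≤⇒≤ᵇ; module ≤-Reasoning)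
open import Data.Fin using (zero; suc)
open import Data.Fin.Subset using (_∉_; _⊆_; _∪_; _─_; ⁅_⁆; ⊤; ⊥; inside; outside)
open import Data.Fin.Subset.Properties
  using (_∈?_; drop-there; drop-∷-⊆; out⊆; in⊆in; ⊆-refl; ⊆-trans; ⊆-antisym; ⊥⊆; ⊆⊤;
         ∣⊥∣≡0; x∈⁅x⁆; ∣⁅x⁆∣≡1; p⊆q⇒∣p∣≤∣q∣; p⊆p∪q; q⊆p∪q; x∈p∪q⁺;
         x∈p∧x∉q⇒x∈p─q; p─q⊆p; x∈p⇒∣p-x∣<∣p∣)
open import Data.Vec using ([]; _∷_; here; there; lookup; tabulate)
open import Data.Vec.Properties using (lookup∘tabulate; []=⇒lookup; lookup⇒[]=)
open import Data.Product using (_×_; _,_; proj₁; ∃; ∃-syntax)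
open import Data.Sum using (_⊎_; inj₁; inj₂)
open import Function using (_∘_; _⇔_; mk⇔; Equivalence)
open import Relation.Binary.PropositionalEquality using (_≡_; refl; sym; trans; cong; cong₂; subst)
open import Relation.Nullary using (yes; no; contradiction)

open Equivalence using (to; from)

private
  variable
    m n : ℕ
    x : Fin n
    p q r : Subset n

∈-tabulate : ∀ (f : Fin n → Bool) → x ∈ tabulate f ⇔ T (f x)
∈-tabulate {x = x} f = mk⇔
  (λ x∈ → from T-≡ (trans (sym (lookup∘tabulate f x)) ([]=⇒lookup x∈)))
  (λ t → lookup⇒[]= x _ (trans (lookup∘tabulate f x) (to T-≡ t)))

∈⇔T-lookup : x ∈ p ⇔ T (lookup p x)
∈⇔T-lookup {x = x} {p = p} = mk⇔ (from T-≡ ∘ []=⇒lookup) (lookup⇒[]= x p ∘ to T-≡)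

T-anyFin : ∀ (f : Fin n → Bool) → T (anyFin f) ⇔ ∃ (T ∘ f)
T-anyFin f = mk⇔ (to′ f) (from′ f)
  where
  to′ : ∀ {n} (f : Fin n → Bool) → T (anyFin f) → ∃ (T ∘ f)
  to′ {suc n} f t with to T-∨ t
  ... | inj₁ t₀ = zero , t₀
  ... | inj₂ t₁ with to′ (f ∘ suc) t₁
  ...   | v , tv = suc v , tv
  from′ : ∀ {n} (f : Fin n → Bool) → ∃ (T ∘ f) → T (anyFin f)
  from′ f (zero  , t) = from T-∨ (inj₁ t)
  from′ f (suc v , t) = from T-∨ (inj₂ (from′ (f ∘ suc) (v , t)))

∣p∪q∣≤∣p∣+∣q∣ : ∀ (p q : Subset n) → ∣ p ∪ q ∣ ≤ ∣ p ∣ + ∣ q ∣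
∣p∪q∣≤∣p∣+∣q∣ []            []            = z≤n
∣p∪q∣≤∣p∣+∣q∣ (outside ∷ p) (outside ∷ q) = ∣p∪q∣≤∣p∣+∣q∣ p q
∣p∪q∣≤∣p∣+∣q∣ (outside ∷ p) (inside  ∷ q) =
  ≤-trans (s≤s (∣p∪q∣≤∣p∣+∣q∣ p q)) (≤-reflexive (sym (+-suc ∣ p ∣ ∣ q ∣)))
∣p∪q∣≤∣p∣+∣q∣ (inside  ∷ p) (outside ∷ q) = s≤s (∣p∪q∣≤∣p∣+∣q∣ p q)
∣p∪q∣≤∣p∣+∣q∣ (inside  ∷ p) (inside  ∷ q) =
  s≤s (≤-trans (∣p∪q∣≤∣p∣+∣q∣ p q) (+-monoʳ-≤ ∣ p ∣ (n≤1+n ∣ q ∣)))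

x∈p─q⇒x∉q : ∀ (p q : Subset n) → x ∈ p ─ q → x ∉ q
x∈p─q⇒x∉q              (_ ∷ p)       (_ ∷ q)       (there x∈p─q) = x∈p─q⇒x∉q p q x∈p─q ∘ drop-there
x∈p─q⇒x∉q              (inside ∷ p)  (outside ∷ q) here ()
x∈p─q⇒x∉q {x = zero}   (_ ∷ p)       (inside ∷ q)  ()
x∈p─q⇒x∉q {x = zero}   (outside ∷ p) (outside ∷ q) ()

p⊆q⇒r─q⊆r─p : p ⊆ q → r ─ q ⊆ r ─ p
p⊆q⇒r─q⊆r─p {q = q} {r = r} p⊆q x∈r─q =
  x∈p∧x∉q⇒x∈p─q (p─q⊆p r q x∈r─q) (x∈p─q⇒x∉q r q x∈r─q ∘ p⊆q)

∣p─q∣+∣q∣≡∣p∣ : ∀ (p q : Subset n) → q ⊆ p → ∣ p ─ q ∣ + ∣ q ∣ ≡ ∣ p ∣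
∣p─q∣+∣q∣≡∣p∣ []            []            _   = refl
∣p─q∣+∣q∣≡∣p∣ (outside ∷ p) (outside ∷ q) q⊆p = ∣p─q∣+∣q∣≡∣p∣ p q (drop-∷-⊆ q⊆p)
∣p─q∣+∣q∣≡∣p∣ (inside  ∷ p) (outside ∷ q) q⊆p = cong suc (∣p─q∣+∣q∣≡∣p∣ p q (drop-∷-⊆ q⊆p))
∣p─q∣+∣q∣≡∣p∣ (inside  ∷ p) (inside  ∷ q) q⊆p =
  trans (+-suc ∣ p ─ q ∣ ∣ q ∣) (cong suc (∣p─q∣+∣q∣≡∣p∣ p q (drop-∷-⊆ q⊆p)))
∣p─q∣+∣q∣≡∣p∣ (outside ∷ p) (inside  ∷ q) q⊆p = contradiction (q⊆p here) λ ()

∣p─q∣≡∣p∣∸∣q∣ : ∀ (p q : Subset n) → q ⊆ p → ∣ p ─ q ∣ ≡ ∣ p ∣ ∸ ∣ q ∣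
∣p─q∣≡∣p∣∸∣q∣ p q q⊆p =
  trans (sym (m+n∸n≡m ∣ p ─ q ∣ ∣ q ∣)) (cong (_∸ ∣ q ∣) (∣p─q∣+∣q∣≡∣p∣ p q q⊆p))

x∈p⇒1≤∣p∣ : x ∈ p → 1 ≤ ∣ p ∣
x∈p⇒1≤∣p∣ x∈p = ≤-trans (s≤s z≤n) (x∈p⇒∣p-x∣<∣p∣ x∈p)

smallest : ℕ → Subset n → Subset n
smallest zero    p             = ⊥
smallest (suc k) []            = []
smallest (suc k) (outside ∷ p) = outside ∷ smallest (suc k) p
smallest (suc k) (inside  ∷ p) = inside ∷ smallest k p

smallest⊆ : ∀ k (p : Subset n) → smallest k p ⊆ p
smallest⊆ zero    p             = ⊥⊆
smallest⊆ (suc k) []            = ⊆-refl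
smallest⊆ (suc k) (outside ∷ p) = out⊆ (smallest⊆ (suc k) p)
smallest⊆ (suc k) (inside  ∷ p) = in⊆in (smallest⊆ k p)

∣smallest∣ : ∀ k (p : Subset n) → ∣ smallest k p ∣ ≡ k ⊓ ∣ p ∣
∣smallest∣ {n = n} zero p      = ∣⊥∣≡0 n
∣smallest∣ (suc k) []            = refl
∣smallest∣ (suc k) (outside ∷ p) = ∣smallest∣ (suc k) p
∣smallest∣ (suc k) (inside  ∷ p) = cong suc (∣smallest∣ k p)

⋃[_]_ : Subset m → (Fin m → Subset n) → Subset n
⋃[ []          ] A = ⊥
⋃[ outside ∷ S ] A = ⋃[ S ] (A ∘ suc)
⋃[ inside  ∷ S ] A = A zero ∪ ⋃[ S ] (A ∘ suc)

⊆⋃ : ∀ (S : Subset m) {A : Fin m → Subset n} {u} → u ∈ S → A u ⊆ ⋃[ S ] A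
⊆⋃ (inside  ∷ S)     here        = p⊆p∪q _
⊆⋃ (inside  ∷ S) {A} (there u∈S) = ⊆-trans (⊆⋃ S u∈S) (q⊆p∪q (A zero) _)
⊆⋃ (outside ∷ S)     (there u∈S) = ⊆⋃ S u∈S

∣⋃∣≤sum : ∀ (S : Subset m) {A : Fin m → Subset n} (f : Fin m → ℕ) →
          (∀ {u} → u ∈ S → ∣ A u ∣ ≤ f u) →
          ∣ ⋃[ S ] A ∣ ≤ sumFin (λ u → if lookup S u then f u else 0)
∣⋃∣≤sum {n = n} []   f bound = ≤-reflexive (∣⊥∣≡0 n)
∣⋃∣≤sum (outside ∷ S) f bound = ∣⋃∣≤sum S (f ∘ suc) (bound ∘ there)
∣⋃∣≤sum (inside  ∷ S) {A} f bound =
  ≤-trans (∣p∪q∣≤∣p∣+∣q∣ (A zero) _) (+-mono-≤ (bound here) (∣⋃∣≤sum S (f ∘ suc) (bound ∘ there)))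

module _ (G : Graph n) where

  ∈N⇔adj : ∀ {v} → x ∈ N G v ⇔ T (adj G v x)
  ∈N⇔adj {v = v} = ∈-tabulate (adj G v)

  ∈closedN⁻ : ∀ {S} → x ∈ closedN G S → x ∈ S ⊎ ∃[ v ] v ∈ S × x ∈ N G v
  ∈closedN⁻ {S = S} x∈ with to T-∨ (to (∈-tabulate _) x∈)
  ... | inj₁ x∈S = inj₁ (from ∈⇔T-lookup x∈S)
  ... | inj₂ t with to (T-anyFin _) t
  ...   | v , tv with to T-∧ tv
  ...     | v∈S , vx = inj₂ (v , from ∈⇔T-lookup v∈S , from ∈N⇔adj vx)

  extPrivate⊆N : ∀ S u → extPrivate G S u ⊆ N G u
  extPrivate⊆N S u x∈ = from ∈N⇔adj (proj₁ (to T-∧ (to (∈-tabulate _) x∈)))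

  module _ (k : ℕ) where

    Forces : Subset n → Fin n → Set
    Forces F v = v ∈ F × 1 ≤ ∣ N G v ─ F ∣ × ∣ N G v ─ F ∣ ≤ k

    canForce⇔Forces : ∀ {F v} → T (canForce G k F v) ⇔ Forces F v
    canForce⇔Forces = mk⇔
      (λ t → let v∈F , t′ = to T-∧ t; lo , hi = to T-∧ t′
             in from ∈⇔T-lookup v∈F , ≤ᵇ⇒≤ 1 _ lo , ≤ᵇ⇒≤ _ k hi)
      (λ (v∈F , lo , hi) → from T-∧ (to ∈⇔T-lookup v∈F , from T-∧ (≤⇒≤ᵇ lo , ≤⇒≤ᵇ hi)))

    ∈stepF⁻ : ∀ {F} → x ∈ stepF G k F → x ∈ F ⊎ ∃[ v ] Forces F v × x ∈ N G v
    ∈stepF⁻ x∈ with to T-∨ (to (∈-tabulate _) x∈)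
    ... | inj₁ x∈F = inj₁ (from ∈⇔T-lookup x∈F)
    ... | inj₂ t with to (T-anyFin _) t
    ...   | v , tv with to T-∧ tv
    ...     | cf , vx = inj₂ (v , to canForce⇔Forces cf , from ∈N⇔adj vx)

    ⊆stepF : ∀ F → F ⊆ stepF G k F
    ⊆stepF F x∈F = from (∈-tabulate _) (from T-∨ (inj₁ (to ∈⇔T-lookup x∈F)))

    forces⇒N⊆stepF : ∀ {F v} → Forces F v → N G v ⊆ stepF G k F
    forces⇒N⊆stepF {v = v} fv x∈N = from (∈-tabulate _) (from T-∨ (inj₂
      (from (T-anyFin _) (v , from T-∧ (from canForce⇔Forces fv , to ∈N⇔adj x∈N)))))

    -- If no neighbour of v is outside F the rule does not fire, but then N(v) ⊆ F already.
    N⊆stepF : ∀ {F v} → v ∈ F → ∣ N G v ─ F ∣ ≤ k → N G v ⊆ stepF G k F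
    N⊆stepF {F} {v} v∈F few {x} x∈N with x ∈? F
    ... | yes x∈F = ⊆stepF F x∈F
    ... | no  x∉F = forces⇒N⊆stepF (v∈F , x∈p⇒1≤∣p∣ (x∈p∧x∉q⇒x∈p─q x∈N x∉F) , few) x∈N

    stepF-mono : ∀ {A B} → A ⊆ B → stepF G k A ⊆ stepF G k B
    stepF-mono {B = B} A⊆B x∈ with ∈stepF⁻ x∈
    ... | inj₁ x∈A = ⊆stepF B (A⊆B x∈A)
    ... | inj₂ (v , (v∈A , _ , few) , x∈N) =
      N⊆stepF (A⊆B v∈A) (≤-trans (p⊆q⇒∣p∣≤∣q∣ (p⊆q⇒r─q⊆r─p {r = N G v} A⊆B)) few) x∈N

    iterF-mono : ∀ i {A B} → A ⊆ B → iterF G k i A ⊆ iterF G k i B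
    iterF-mono zero    A⊆B = A⊆B
    iterF-mono (suc i) A⊆B = stepF-mono (iterF-mono i A⊆B)

    iterF-suc : ∀ i A → iterF G k (suc i) A ≡ iterF G k i (stepF G k A)
    iterF-suc zero    A = refl
    iterF-suc (suc i) A = cong (stepF G k) (iterF-suc i A)

    closedN⊆stepF : ∀ {S F} → S ⊆ F → (∀ {u} → u ∈ S → ∣ N G u ─ F ∣ ≤ k) →
                    closedN G S ⊆ stepF G k F
    closedN⊆stepF S⊆F few x∈ with ∈closedN⁻ x∈
    ... | inj₁ x∈S            = ⊆stepF _ (S⊆F x∈S)
    ... | inj₂ (v , v∈S , x∈N) = N⊆stepF (S⊆F v∈S) (few v∈S) x∈N

    kForcing-from-kPDS : ∀ {S F} → IsKPowerDominating G k S → closedN G S ⊆ stepF G k F →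
                         IsKForcing G k F
    kForcing-from-kPDS {F = F} (ℓ , Pℓ≡⊤) N[S]⊆ =
      suc ℓ , ⊆-antisym ⊆⊤ (subst (⊤ ⊆_) (sym (iterF-suc ℓ F))
                              (subst (_⊆ _) Pℓ≡⊤ (iterF-mono ℓ N[S]⊆)))

    module _ (S : Subset n) where

      kept : Fin n → Subset n
      kept u = ⁅ u ⁆ ∪ (N G u ─ smallest k (N G u))

      forcingSet : Subset n
      forcingSet = ⋃[ S ] kept

      S⊆forcingSet : S ⊆ forcingSet
      S⊆forcingSet u∈S = ⊆⋃ S u∈S (x∈p∪q⁺ (inj₁ (x∈⁅x⁆ _)))

      N─forcingSet⊆smallest : ∀ {u} → u ∈ S → N G u ─ forcingSet ⊆ smallest k (N G u)
      N─forcingSet⊆smallest {u} u∈S {x} x∈ with x ∈? smallest k (N G u)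
      ... | yes x∈Q = x∈Q
      ... | no  x∉Q = contradiction
        (⊆⋃ S u∈S (x∈p∪q⁺ (inj₂ (x∈p∧x∉q⇒x∈p─q (p─q⊆p _ _ x∈) x∉Q))))
        (x∈p─q⇒x∉q (N G u) forcingSet x∈)

      ∣N─forcingSet∣≤k : ∀ {u} → u ∈ S → ∣ N G u ─ forcingSet ∣ ≤ k
      ∣N─forcingSet∣≤k {u} u∈S = ≤-trans (p⊆q⇒∣p∣≤∣q∣ (N─forcingSet⊆smallest u∈S))
        (≤-trans (≤-reflexive (∣smallest∣ k (N G u))) (m⊓n≤m k (deg G u)))

      forcingSet-isKForcing : IsKPowerDominating G k S → IsKForcing G k forcingSet
      forcingSet-isKForcing pds =
        kForcing-from-kPDS {S = S} pds (closedN⊆stepF S⊆forcingSet ∣N─forcingSet∣≤k)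

      ∣kept∣≤deg+1∸k : ∀ u → k ≤ deg G u → ∣ kept u ∣ ≤ deg G u + 1 ∸ k
      ∣kept∣≤deg+1∸k u k≤deg = begin
        ∣ kept u ∣                  ≤⟨ ∣p∪q∣≤∣p∣+∣q∣ ⁅ u ⁆ _ ⟩
        ∣ ⁅ u ⁆ ∣ + ∣ N G u ─ Q ∣    ≡⟨ cong₂ _+_ (∣⁅x⁆∣≡1 u) (∣p─q∣≡∣p∣∸∣q∣ (N G u) Q (smallest⊆ k _)) ⟩
        1 + (deg G u ∸ ∣ Q ∣)       ≡⟨ cong (λ c → 1 + (deg G u ∸ c)) ∣Q∣≡k ⟩
        1 + (deg G u ∸ k)           ≡⟨ +-comm 1 _ ⟩
        deg G u ∸ k + 1             ≡⟨ sym (+-∸-comm 1 k≤deg) ⟩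
        deg G u + 1 ∸ k             ∎
        where
        open ≤-Reasoning
        Q = smallest k (N G u)
        ∣Q∣≡k : ∣ Q ∣ ≡ k
        ∣Q∣≡k = trans (∣smallest∣ k (N G u)) (m≤n⇒m⊓n≡m k≤deg)

      ∣forcingSet∣≤sumOver : (∀ {u} → u ∈ S → k ≤ deg G u) →
                      ∣ forcingSet ∣ ≤ sumOver G S (λ u → deg G u + 1 ∸ k)
      ∣forcingSet∣≤sumOver k≤deg = ∣⋃∣≤sum S _ (λ {u} u∈S → ∣kept∣≤deg+1∸k u (k≤deg u∈S))

lemma5p3 : ∀ {n : ℕ} (G : Graph n) (k : ℕ) → Connected G → MaxDegAtLeast G (k + 2)
    → (S : Subset n) → IsMinimumKPDS G k S
    → (∀ u → u ∈ S → k + 1 ≤ ∣ extPrivate G S u ∣)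
    → ∀ z → IsZk G k z
    → z ≤ sumOver G S (λ u → deg G u + 1 ∸ k)
lemma5p3 G k _ _ S (pds , _) private≥ z (_ , z≤) =
  ≤-trans (z≤ _ (forcingSet-isKForcing G k S pds)) (∣forcingSet∣≤sumOver G k S k≤deg)
  where
  k≤deg : ∀ {u} → u ∈ S → k ≤ deg G u
  k≤deg {u} u∈S = ≤-trans (m≤m+n k 1)
    (≤-trans (private≥ u u∈S) (p⊆q⇒∣p∣≤∣q∣ (extPrivate⊆N G S u)))
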